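{- Let $G$ be a strongly connected signed digraph with vertex set $V$, and suppose that there is a vertex $i$, or an arc from some $j$ to $i$, that belongs to every negative cycle of $G$ and to no positive cycle of $G$. Then there is $I\subseteq V$ such that in the $I$-switch $G^I$ all negative arcs have $i$ as terminal vertex.
   Context: A signed digraph $G=(V,E)$ has finite vertex set $V$ and arcs $E\subseteq V\times V\times\{ -1,1\}$ ($(j,i,s)$: arc from $j$ to $i$ of sign $s$; loops and opposite-sign parallel arcs allowed). Cycles are simple subgraphs; sign = product of arc signs; strong connectivity refers to the underlying digraph. For $I\subseteq V$ let $\sigma_I(v)=1$ if $v\in I$ and $\sigma_I(v)=-1$ otherwise; the $I$-switch of $G$ is $G^I=(V,\{(j,i,\sigma_I(j)\,s\,\sigma_I(i)):(j,i,s)\in E\})$. -}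

module Defs where

open import Data.Nat using (ℕ; zero; suc; _<?_)
open import Data.Fin using (Fin; zero; suc; toℕ; fromℕ<)
open import Data.Fin.Subset using (Subset)
open import Data.Vec using (lookup)
open import Data.Bool using (true; false)
open import Data.Sign using (Sign; +; -; _*_)
open import Data.Product using (Σ; _×_; ∃)
open import Relation.Nullary using (yes; no; ¬_)
open import Relation.Binary.PropositionalEquality using (_≡_)
open import Function.Definitions using (Injective)

-- A signed digraph on vertex set Fin n: its arc set E ⊆ V × V × {-1,1},
-- given as a predicate; E j i s means the arc (j , i , s) is present
-- (arc from j to i with sign s).
SignedDigraph : ℕ → Set₁
SignedDigraph n = Fin n → Fin n → Sign → Set

data Reach {n : ℕ} (E : SignedDigraph n) : Fin n → Fin n → Set where
  here : ∀ {u} → Reach E u u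
  step : ∀ {u w v s} → E u w s → Reach E w v → Reach E u v

StronglyConnected : ∀ {n} → SignedDigraph n → Set
StronglyConnected {n} E = ∀ (u v : Fin n) → Reach E u v

next : ∀ {k} → Fin (suc k) → Fin (suc k)
next {k} t with toℕ t <? k
... | yes p = suc (fromℕ< p)
... | no _  = zero

prod : ∀ {k} → (Fin k → Sign) → Sign
prod {zero}  f = +
prod {suc k} f = f zero * prod (λ t → f (suc t))

-- A (simple, directed) cycle: distinct vertices v₀ … v_k with arcs
-- (v_t , v_{t+1 mod (k+1)} , s_t) ∈ E.  Loops are the case k = 0.
record Cycle {n : ℕ} (E : SignedDigraph n) : Set where
  field
    len    : ℕ
    vert   : Fin (suc len) → Fin n
    inj    : Injective _≡_ _≡_ vert
    sgn    : Fin (suc len) → Sign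
    arc    : ∀ t → E (vert t) (vert (next t)) (sgn t)

  sign : Sign
  sign = prod sgn

open Cycle public

VertexOn : ∀ {n} {E : SignedDigraph n} → Fin n → Cycle E → Set
VertexOn i C = ∃ λ t → vert C t ≡ i

ArcOn : ∀ {n} {E : SignedDigraph n} → Fin n → Fin n → Sign → Cycle E → Set
ArcOn j i s C = ∃ λ t → vert C t ≡ j × vert C (next t) ≡ i × sgn C t ≡ s

σ : ∀ {n} → Subset n → Fin n → Sign
σ I v with lookup I v
... | true  = +
... | false = -

switch : ∀ {n} → SignedDigraph n → Subset n → SignedDigraph n
switch E I j i s′ = Σ Sign λ s → E j i s × s′ ≡ σ I j * s * σ I i

VertexHyp : ∀ {n} → SignedDigraph n → Fin n → Set
VertexHyp E i = ∀ (C : Cycle E) →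
  (sign C ≡ - → VertexOn i C) × (sign C ≡ + → ¬ VertexOn i C)

ArcHyp : ∀ {n} → SignedDigraph n → Fin n → Fin n → Sign → Set
ArcHyp E j i s = ∀ (C : Cycle E) →
  (sign C ≡ - → ArcOn j i s C) × (sign C ≡ + → ¬ ArcOn j i s C)

{-# OPTIONS --safe #-}
module Submission where

-- Mark by -1 the arcs entering i (vertex case) or the arc (j , i , s) (arc case), and
-- reweight every arc by the product of its sign and its mark. A simple cycle uses at
-- most one marked arc, and by hypothesis it uses one exactly when it is negative, so
-- every cycle has reweighted sign +1. Erasing loops extends this to all closed walks;
-- by strong connectivity the reweighted sign p v of a walk from a fixed root to v is
-- then a potential: p b = p a * s * mark for every arc (a , b , s). Switching by
-- I = {v | p v = +1} turns the sign of every arc into its mark, so only marked arcs,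
-- all of which end at i, remain negative.

open import Defs
open import Data.Nat using (ℕ)
open import Data.Fin using (Fin)
open import Data.Fin.Subset using (Subset)
open import Data.Sign using (Sign; -)
open import Data.Product using (Σ; ∃; _×_)
open import Data.Sum using (_⊎_)
open import Relation.Binary.PropositionalEquality using (_≡_)

open import Data.Empty using (⊥-elim)
open import Data.Fin using (zero; suc; toℕ; fromℕ; inject₁; _≟_)
open import Data.Fin.Properties
  using (toℕ-injective; toℕ-inject₁; toℕ-fromℕ; toℕ-fromℕ<; toℕ≤pred[n];
         inject₁-injective; fromℕ≢inject₁; suc-injective; 0≢1+n)
open import Data.List using (List; []; _∷_; _++_)
open import Data.List.Membership.Propositional using (_∈_; _∉_)
open import Data.List.Membership.Propositional.Properties using (∈-++⁺ˡ)
open import Data.List.Relation.Unary.Any using (here; there; any?)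
import Data.Nat as ℕ
open import Data.Nat.Properties using (≤-antisym; ≮⇒≥)
open import Data.Product using (_,_; proj₁; proj₂)
open import Data.Sign using (+; _*_)
import Data.Sign as Sign
open import Data.Sign.Properties using (*-assoc; s*s≡+; *-group; *-commutativeSemigroup)
open import Algebra.Properties.Group *-group using (x∙y⁻¹≈ε⇒x≈y)
open import Algebra.Properties.CommutativeSemigroup *-commutativeSemigroup using (interchange)
open import Data.Sum using (inj₁; inj₂)
open import Data.Unit using (⊤; tt)
open import Data.Vec using (tabulate)
open import Data.Vec.Properties using (lookup∘tabulate)
open import Function using (_∘_)
open import Function.Definitions using (Injective)
open import Relation.Nullary using (Dec; yes; no; does; ¬_)
open import Relation.Nullary.Decidable using (_×-dec_)
open import Relation.Binary.PropositionalEquality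
  using (refl; sym; trans; cong; cong₂; subst; module ≡-Reasoning)

private variable
  n k : ℕ

Weighting : ℕ → Set
Weighting n = Fin n → Fin n → Sign → Sign

mark : {P : Set} → Dec P → Sign
mark (yes _) = -
mark (no _)  = +

mark≡-⇒ : {P : Set} (d : Dec P) → mark d ≡ - → P
mark≡-⇒ (yes p) _ = p

x*y≡+⇒x≡y : ∀ {x y} → x * y ≡ + → x ≡ y
x*y≡+⇒x≡y = x∙y⁻¹≈ε⇒x≈y _ _

x*s*[x*[s*m]]≡m : ∀ x s m → x * s * (x * (s * m)) ≡ m
x*s*[x*[s*m]]≡m + + m = refl
x*s*[x*[s*m]]≡m + - - = refl
x*s*[x*[s*m]]≡m + - + = refl
x*s*[x*[s*m]]≡m - + - = refl
x*s*[x*[s*m]]≡m - + + = refl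
x*s*[x*[s*m]]≡m - - - = refl
x*s*[x*[s*m]]≡m - - + = refl

cycleWeight : {E : SignedDigraph n} → Weighting n → Cycle E → Sign
cycleWeight w C = prod (λ t → w (vert C t) (vert C (next t)) (sgn C t))

prod-cong : {f g : Fin k → Sign} → (∀ t → f t ≡ g t) → prod f ≡ prod g
prod-cong {k = ℕ.zero}  f≗g = refl
prod-cong {k = ℕ.suc k} f≗g = cong₂ _*_ (f≗g zero) (prod-cong (λ t → f≗g (suc t)))

prod-* : (f g : Fin k → Sign) → prod (λ t → f t * g t) ≡ prod f * prod g
prod-* {k = ℕ.zero}  f g = refl
prod-* {k = ℕ.suc k} f g = begin
  f zero * g zero * prod (λ t → f (suc t) * g (suc t))
    ≡⟨ cong (f zero * g zero *_) (prod-* (λ t → f (suc t)) (λ t → g (suc t))) ⟩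
  f zero * g zero * (prod (λ t → f (suc t)) * prod (λ t → g (suc t)))
    ≡⟨ interchange (f zero) (g zero) _ _ ⟩
  f zero * prod (λ t → f (suc t)) * (g zero * prod (λ t → g (suc t)))
    ∎
  where open ≡-Reasoning

prod-mark-absent : {P : Fin k → Set} (P? : ∀ t → Dec (P t)) →
  (∀ t → ¬ P t) → prod (λ t → mark (P? t)) ≡ +
prod-mark-absent {k = ℕ.zero}  P? ¬P = refl
prod-mark-absent {k = ℕ.suc k} P? ¬P with P? zero
... | yes p = ⊥-elim (¬P zero p)
... | no _  = prod-mark-absent (λ t → P? (suc t)) (λ t → ¬P (suc t))

prod-mark-unique : {P : Fin k → Set} (P? : ∀ t → Dec (P t)) →
  (∀ {t t′} → P t → P t′ → t ≡ t′) → ∀ {t} → P t → prod (λ t → mark (P? t)) ≡ -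
prod-mark-unique P? unique {zero} p with P? zero
... | no ¬p = ⊥-elim (¬p p)
... | yes _ = cong (- *_) (prod-mark-absent (λ t → P? (suc t)) (λ t q → 0≢1+n (unique p q)))
prod-mark-unique P? unique {suc t} p with P? zero
... | yes q = ⊥-elim (0≢1+n (unique q p))
... | no _  = prod-mark-unique (λ t → P? (suc t)) (λ q q′ → suc-injective (unique q q′)) p

next-last-or-inject₁ : (t : Fin (ℕ.suc k)) →
  (t ≡ fromℕ k × next t ≡ zero) ⊎ inject₁ (next t) ≡ suc t
next-last-or-inject₁ {k} t with toℕ t ℕ.<? k
... | yes t<k = inj₂ (cong suc (toℕ-injective (trans (toℕ-inject₁ _) (toℕ-fromℕ< t<k))))
... | no  t≮k = inj₁ (toℕ-injective t≡k , refl)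
  where
  t≡k : toℕ t ≡ toℕ (fromℕ k)
  t≡k = trans (≤-antisym (toℕ≤pred[n] t) (≮⇒≥ t≮k)) (sym (toℕ-fromℕ k))

next-injective : Injective _≡_ _≡_ (next {k})
next-injective {k} {t} {t′} eq with next-last-or-inject₁ t | next-last-or-inject₁ t′
... | inj₁ (t≡last , _) | inj₁ (t′≡last , _) = trans t≡last (sym t′≡last)
... | inj₂ t+1          | inj₂ t′+1          =
  suc-injective (trans (sym t+1) (trans (cong inject₁ eq) t′+1))
... | inj₁ (_ , t↦0)    | inj₂ t′+1          =
  ⊥-elim (0≢1+n (trans (cong inject₁ (trans (sym t↦0) eq)) t′+1))
... | inj₂ t+1          | inj₁ (_ , t′↦0)    =
  ⊥-elim (0≢1+n (trans (cong inject₁ (trans (sym t′↦0) (sym eq))) t+1))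

next-surjective : (t′ : Fin (ℕ.suc k)) → ∃ λ t → next t ≡ t′
next-surjective {k} zero with next-last-or-inject₁ (fromℕ k)
... | inj₁ (_ , last↦0) = fromℕ k , last↦0
... | inj₂ last+1       = ⊥-elim (fromℕ≢inject₁ (sym last+1))
next-surjective (suc t′) with next-last-or-inject₁ (inject₁ t′)
... | inj₁ (t′≡last , _) = ⊥-elim (fromℕ≢inject₁ (sym t′≡last))
... | inj₂ t′+1          = inject₁ t′ , inject₁-injective t′+1

module _ {E : SignedDigraph n} where

  private variable
    u x y z : Fin n

  length : Reach E x y → ℕ
  length here       = 0
  length (step e W) = ℕ.suc (length W)

  infixr 5 _⊕_

  _⊕_ : Reach E x y → Reach E y z → Reach E x z
  here     ⊕ B = B
  step e A ⊕ B = step e (A ⊕ B)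

  weight : Weighting n → Reach E x y → Sign
  weight w here                         = +
  weight w (step {u} {v} {_} {s} e W) = w u v s * weight w W

  weight-⊕ : (w : Weighting n) (A : Reach E x y) (B : Reach E y z) →
    weight w (A ⊕ B) ≡ weight w A * weight w B
  weight-⊕ w here B = refl
  weight-⊕ w (step {u} {v} {_} {s} e A) B =
    trans (cong (w u v s *_) (weight-⊕ w A B)) (sym (*-assoc (w u v s) _ _))

  sources : Reach E x y → List (Fin n)
  sources here           = []
  sources (step {u} e W) = u ∷ sources W

  sources-⊕ : (A : Reach E x y) (B : Reach E y z) → sources (A ⊕ B) ≡ sources A ++ sources B
  sources-⊕ here       B = refl
  sources-⊕ (step e A) B = cong (_ ∷_) (sources-⊕ A B)

  Simple : Reach E x y → Set
  Simple here           = ⊤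
  Simple (step {u} e W) = u ∉ sources W × Simple W

  Simple-⊕⁻ : (A : Reach E x y) (B : Reach E y z) → Simple (A ⊕ B) → Simple A × Simple B
  Simple-⊕⁻ here       B simple           = tt , simple
  Simple-⊕⁻ (step e A) B (u∉A⊕B , simple) = (u∉A , proj₁ parts) , proj₂ parts
    where
    parts = Simple-⊕⁻ A B simple
    u∉A : _ ∉ sources A
    u∉A u∈A = u∉A⊕B (subst (_ ∈_) (sym (sources-⊕ A B)) (∈-++⁺ˡ u∈A))

  record Cut (P : Reach E x y) (u : Fin n) : Set where
    field
      before : Reach E x u
      after  : Reach E u y
      split  : P ≡ before ⊕ after
      first  : u ∉ sources before

  cut : (P : Reach E x y) → Simple P → u ∈ sources P → Cut P u
  cut P@(step _ _) _ (here refl) = record { before = here ; after = P ; split = refl ; first = λ () }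
  cut (step e P) (x∉P , simple) (there u∈P) = record
    { before = step e before
    ; after  = after
    ; split  = cong (step e) split
    ; first  = λ { (here refl) → x∉P u∈P ; (there u∈before) → first u∈before }
    }
    where open Cut (cut P simple u∈P)

  module _ (w : Weighting n)
           (simple-closed-positive : ∀ {u} (W : Reach E u u) → Simple W → weight w W ≡ +) where

    loop-erase : (W : Reach E x y) → ∃ λ (P : Reach E x y) → Simple P × weight w W ≡ weight w P
    loop-erase here = here , tt , refl
    loop-erase (step {u} {v} {_} {s} e W) with loop-erase W
    ... | P , simple , wW≡wP with any? (u ≟_) (sources P)
    ...   | no u∉P  = step e P , (u∉P , simple) , cong (w u v s *_) wW≡wP
    ...   | yes u∈P = after , proj₂ parts , (begin
      w u v s * weight w W                         ≡⟨ cong (w u v s *_) wW≡wP ⟩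
      w u v s * weight w P                         ≡⟨ cong (λ Q → w u v s * weight w Q) split ⟩
      w u v s * weight w (before ⊕ after)          ≡⟨ cong (w u v s *_) (weight-⊕ w before after) ⟩
      w u v s * (weight w before * weight w after) ≡⟨ sym (*-assoc (w u v s) _ _) ⟩
      weight w (step e before) * weight w after    ≡⟨ cong (_* weight w after) loop-positive ⟩
      weight w after                               ∎)
      where
      open Cut (cut P simple u∈P)
      open ≡-Reasoning
      parts : Simple before × Simple after
      parts = Simple-⊕⁻ before after (subst Simple split simple)
      loop-positive : weight w (step e before) ≡ +
      loop-positive = simple-closed-positive (step e before) (first , proj₁ parts)

    closed-positive : (W : Reach E u u) → weight w W ≡ +
    closed-positive W with loop-erase W
    ... | P , simple , wW≡wP = trans wW≡wP (simple-closed-positive P simple)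

  vertex : (W : Reach E x y) → Fin (ℕ.suc (length W)) → Fin n
  vertex {x} W zero       = x
  vertex (step e W) (suc t) = vertex W t

  arcSign : (W : Reach E x y) → Fin (length W) → Sign
  arcSign (step {s = s} e W) zero = s
  arcSign (step e W) (suc t)      = arcSign W t

  arc-at : (W : Reach E x y) (t : Fin (length W)) →
    E (vertex W (inject₁ t)) (vertex W (suc t)) (arcSign W t)
  arc-at (step e W) zero    = e
  arc-at (step e W) (suc t) = arc-at W t

  vertex-last : (W : Reach E x y) → vertex W (fromℕ (length W)) ≡ y
  vertex-last here       = refl
  vertex-last (step e W) = vertex-last W

  vertex-source : (W : Reach E x y) (t : Fin (length W)) → vertex W (inject₁ t) ∈ sources W
  vertex-source (step e W) zero    = here refl
  vertex-source (step e W) (suc t) = there (vertex-source W t)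

  vertex-injective : (W : Reach E x y) → Simple W → Injective _≡_ _≡_ (λ t → vertex W (inject₁ t))
  vertex-injective (step e W) _            {zero}  {zero}   _  = refl
  vertex-injective (step e W) (x∉W , _)    {zero}  {suc t′} eq =
    ⊥-elim (x∉W (subst (_∈ sources W) (sym eq) (vertex-source W t′)))
  vertex-injective (step e W) (x∉W , _)    {suc t} {zero}   eq =
    ⊥-elim (x∉W (subst (_∈ sources W) eq (vertex-source W t)))
  vertex-injective (step e W) (_ , simple) {suc t} {suc t′} eq = cong suc (vertex-injective W simple eq)

  weight-prod : (w : Weighting n) (W : Reach E x y) →
    weight w W ≡ prod (λ t → w (vertex W (inject₁ t)) (vertex W (suc t)) (arcSign W t))
  weight-prod w here = refl
  weight-prod w (step {u} {v} {_} {s} e W) = cong (w u v s *_) (weight-prod w W)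

  vertex-next : ∀ {s} (e : E u x s) (W : Reach E x u) (t : Fin (ℕ.suc (length W))) →
    vertex (step e W) (inject₁ (next t)) ≡ vertex (step e W) (suc t)
  vertex-next e W t with next-last-or-inject₁ t
  ... | inj₂ t+1 = cong (vertex (step e W)) t+1
  ... | inj₁ (refl , last↦0) =
    trans (cong (λ t → vertex (step e W) (inject₁ t)) last↦0) (sym (vertex-last W))

  closed-walk-cycle : ∀ {s} (e : E u x s) (W : Reach E x u) → Simple (step e W) → Cycle E
  closed-walk-cycle e W simple = record
    { len  = length W
    ; vert = λ t → vertex (step e W) (inject₁ t)
    ; inj  = vertex-injective (step e W) simple
    ; sgn  = arcSign (step e W)
    ; arc  = λ t → subst (λ b → E (vertex (step e W) (inject₁ t)) b (arcSign (step e W) t))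
                         (sym (vertex-next e W t)) (arc-at (step e W) t)
    }

  cycleWeight-closed-walk-cycle : (w : Weighting n) {s : Sign} (e : E u x s) (W : Reach E x u)
    (simple : Simple (step e W)) → cycleWeight w (closed-walk-cycle e W simple) ≡ weight w (step e W)
  cycleWeight-closed-walk-cycle w e W simple =
    trans (prod-cong (λ t → cong (λ b → w (vertex (step e W) (inject₁ t)) b (arcSign (step e W) t))
                                 (vertex-next e W t)))
          (sym (weight-prod w (step e W)))

  cycles-positive⇒closed-positive : (w : Weighting n) → (∀ (C : Cycle E) → cycleWeight w C ≡ +) →
    (W : Reach E u u) → weight w W ≡ +
  cycles-positive⇒closed-positive w positive = closed-positive w simple-closed-positive
    where
    simple-closed-positive : (W : Reach E u u) → Simple W → weight w W ≡ +
    simple-closed-positive here       _      = refl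
    simple-closed-positive (step e W) simple =
      trans (sym (cycleWeight-closed-walk-cycle w e W simple)) (positive (closed-walk-cycle e W simple))

Potential : SignedDigraph n → Weighting n → (Fin n → Sign) → Set
Potential E w p = ∀ {a b s} → E a b s → p b ≡ p a * w a b s

potential : {E : SignedDigraph n} (w : Weighting n) → StronglyConnected E →
  (∀ {u} (W : Reach E u u) → weight w W ≡ +) → ∃ (Potential E w)
potential {n = ℕ.zero}  w _         _              = (λ ()) , λ { {()} }
potential {n = ℕ.suc n} w connected closed-positive = p , p-potential
  where
  p : Fin (ℕ.suc n) → Sign
  p v = weight w (connected zero v)

  p-potential : Potential _ w p
  p-potential {a} {b} {s} e = trans (x*y≡+⇒x≡y back-b) (sym (x*y≡+⇒x≡y back-a))
    where
    back = weight w (connected b zero)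
    back-b : p b * back ≡ +
    back-b = trans (sym (weight-⊕ w (connected zero b) (connected b zero)))
                   (closed-positive (connected zero b ⊕ connected b zero))
    back-a : p a * w a b s * back ≡ +
    back-a = trans (*-assoc (p a) _ _)
                   (trans (sym (weight-⊕ w (connected zero a) (step e (connected b zero))))
                          (closed-positive (connected zero a ⊕ step e (connected b zero))))

switching : (Fin n → Sign) → Subset n
switching p = tabulate (λ v → does (p v Sign.≟ +))

σ-switching : (p : Fin n → Sign) (v : Fin n) → σ (switching p) v ≡ p v
σ-switching p v rewrite lookup∘tabulate (λ v → does (p v Sign.≟ +)) v with p v
... | + = refl
... | - = refl

ArcPredicate : ℕ → Set₁
ArcPredicate n = Fin n → Fin n → Sign → Set

module _ {E : SignedDigraph n} (M : ArcPredicate n) where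

  MarkedAt : (C : Cycle E) → Fin (ℕ.suc (len C)) → Set
  MarkedAt C t = M (vert C t) (vert C (next t)) (sgn C t)

  Meets : Cycle E → Set
  Meets C = ∃ (MarkedAt C)

-- ArcHyp E j i s is, definitionally, this property of the single arc (j , i , s).
MarksNegativeCycles : SignedDigraph n → ArcPredicate n → Set
MarksNegativeCycles E M = ∀ (C : Cycle E) → (sign C ≡ - → Meets M C) × (sign C ≡ + → ¬ Meets M C)

MarkedAtMostOnce : SignedDigraph n → ArcPredicate n → Set
MarkedAtMostOnce E M = ∀ (C : Cycle E) {t t′} → MarkedAt M C t → MarkedAt M C t′ → t ≡ t′

module _ {E : SignedDigraph n} {M : ArcPredicate n} (M? : ∀ a b s → Dec (M a b s))
         (once : MarkedAtMostOnce E M) (marks : MarksNegativeCycles E M) where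

  markedWeighting : Weighting n
  markedWeighting a b s = s * mark (M? a b s)

  marksAlong : (C : Cycle E) → Fin (ℕ.suc (len C)) → Sign
  marksAlong C t = mark (M? (vert C t) (vert C (next t)) (sgn C t))

  product-of-marks≡sign : (C : Cycle E) → prod (marksAlong C) ≡ sign C
  product-of-marks≡sign C with sign C | marks C
  ... | - | negative , _ = prod-mark-unique (λ t → M? _ _ _) (once C) (proj₂ (negative refl))
  ... | + | _ , positive = prod-mark-absent (λ t → M? _ _ _) (λ t m → positive refl (t , m))

  markedWeighting-cycles-positive : (C : Cycle E) → cycleWeight markedWeighting C ≡ +
  markedWeighting-cycles-positive C = begin
    cycleWeight markedWeighting C ≡⟨ prod-* (sgn C) (marksAlong C) ⟩
    sign C * prod (marksAlong C)  ≡⟨ cong (sign C *_) (product-of-marks≡sign C) ⟩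
    sign C * sign C               ≡⟨ s*s≡+ (sign C) ⟩
    +                             ∎
    where open ≡-Reasoning

  switch-to-marks : StronglyConnected E →
    ∃ λ (I : Subset n) → ∀ {a b s} → E a b s → σ I a * s * σ I b ≡ mark (M? a b s)
  switch-to-marks connected
    with potential markedWeighting connected
           (cycles-positive⇒closed-positive markedWeighting markedWeighting-cycles-positive)
  ... | p , p-potential = switching p , λ {a} {b} {s} e → begin
    σ (switching p) a * s * σ (switching p) b
      ≡⟨ cong₂ (λ x y → x * s * y) (σ-switching p a) (σ-switching p b) ⟩
    p a * s * p b                             ≡⟨ cong (p a * s *_) (p-potential e) ⟩
    p a * s * (p a * (s * mark (M? a b s)))   ≡⟨ x*s*[x*[s*m]]≡m (p a) s _ ⟩
    mark (M? a b s)                           ∎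
    where open ≡-Reasoning

  negative-arcs-marked : StronglyConnected E →
    ∃ λ (I : Subset n) → ∀ a b → switch E I a b - → ∃ (M a b)
  negative-arcs-marked connected with switch-to-marks connected
  ... | I , switched = I , λ { a b (s , e , negative) →
    s , mark≡-⇒ (M? a b s) (trans (sym (switched e)) (sym negative)) }

marked-arcs-enter : {E : SignedDigraph n} {M : ArcPredicate n} (i : Fin n) →
  (∀ {a b s} → M a b s → b ≡ i) →
  (∃ λ (I : Subset n) → ∀ a b → switch E I a b - → ∃ (M a b)) →
  ∃ λ (I : Subset n) → ∀ a b → switch E I a b - → b ≡ i
marked-arcs-enter i enters (I , marked) = I , λ a b negative → enters (proj₂ (marked a b negative))

module _ {E : SignedDigraph n} (i : Fin n) where

  arcs-into-once : MarkedAtMostOnce E (λ _ b _ → b ≡ i)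
  arcs-into-once C b≡i b′≡i = next-injective (inj C (trans b≡i (sym b′≡i)))

  VertexHyp⇒MarksNegativeCycles : VertexHyp E i → MarksNegativeCycles E (λ _ b _ → b ≡ i)
  VertexHyp⇒MarksNegativeCycles hyp C =
    on⇒meets ∘ proj₁ (hyp C) , λ positive (t , m) → proj₂ (hyp C) positive (next t , m)
    where
    on⇒meets : VertexOn i C → Meets (λ _ b _ → b ≡ i) C
    on⇒meets (t , vt≡i) with next-surjective t
    ... | t′ , t′↦t = t′ , trans (cong (vert C) t′↦t) vt≡i

  single-arc-once : ∀ {j s} → MarkedAtMostOnce E (λ a b s′ → a ≡ j × b ≡ i × s′ ≡ s)
  single-arc-once C (a≡j , _) (a′≡j , _) = inj C (trans a≡j (sym a′≡j))

lemma38 : ∀ {n : ℕ} (E : SignedDigraph n) (i : Fin n) →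
    StronglyConnected E →
    (VertexHyp E i ⊎ (Σ (Fin n) λ j → Σ Sign λ s → E j i s × ArcHyp E j i s)) →
    ∃ λ (I : Subset n) → ∀ (j k : Fin n) → switch E I j k - → k ≡ i
lemma38 E i connected (inj₁ vertexHyp) =
  marked-arcs-enter i (λ b≡i → b≡i)
    (negative-arcs-marked (λ _ b _ → b ≟ i) (arcs-into-once i)
                          (VertexHyp⇒MarksNegativeCycles i vertexHyp) connected)
lemma38 E i connected (inj₂ (j , s , _ , arcHyp)) =
  marked-arcs-enter i (λ (_ , b≡i , _) → b≡i)
    (negative-arcs-marked (λ a b s′ → a ≟ j ×-dec b ≟ i ×-dec s′ Sign.≟ s) (single-arc-once i)
                          arcHyp connected)
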